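{- Let $G$ be a finite simple undirected graph with $n$ vertices, $m\ge 1$ edges and $k$ connected components. Then the number of acyclic orientations of $G$ is at most $\left(\frac{m\,\mathrm{e}}{n-k}\right)^{n-k}$.
   Context: An orientation of $G$ assigns a direction to each edge; it is acyclic if the resulting digraph has no directed cycle. $\mathrm{e}$ is Euler's number. -}

module Defs where

open import Data.Nat using (ℕ; zero; suc; _+_; _*_; _^_; _≤_; _<_; _!)
open import Data.Fin using (Fin; toℕ)
open import Data.Bool using (Bool; true; false)
open import Data.Vec using (Vec; lookup)
open import Data.Product using (_×_; _,_; proj₁; proj₂; ∃; ∃-syntax; Σ)
open import Data.Sum using (_⊎_)
open import Relation.Nullary using (¬_)
open import Relation.Binary.PropositionalEquality using (_≡_)
open import Relation.Binary.Construct.Closure.Transitive using (TransClosure)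
open import Relation.Binary.Construct.Closure.ReflexiveTransitive using (Star)

-- Edge e is the unordered pair {u,v}, stored as (u , v) with u < v
-- (so no loops), and distinct indices give distinct edges (no multi-edges).
record SimpleGraph (n m : ℕ) : Set where
  field
    edges    : Vec (Fin n × Fin n) m
    ordered  : ∀ e → toℕ (proj₁ (lookup edges e)) < toℕ (proj₂ (lookup edges e))
    distinct : ∀ e e′ → lookup edges e ≡ lookup edges e′ → e ≡ e′

open SimpleGraph public

module _ {n m : ℕ} (G : SimpleGraph n m) where

  Adj : Fin n → Fin n → Set
  Adj u v = ∃[ e ] (lookup (edges G) e ≡ (u , v) ⊎ lookup (edges G) e ≡ (v , u))

  Connected : Fin n → Fin n → Set
  Connected = Star Adj

  HasComponents : ℕ → Set
  HasComponents k =
    Σ (Fin n → Fin k) λ c →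
      (∀ j → ∃[ i ] c i ≡ j) ×
      (∀ i j → (c i ≡ c j → Connected i j) × (Connected i j → c i ≡ c j))

  -- An orientation assigns a direction to every edge:
  -- true means (u , v) is directed u → v, false means v → u.
  Orientation : Set
  Orientation = Vec Bool m

  Arc : Orientation → Fin n → Fin n → Set
  Arc o u v = ∃[ e ]
    ((lookup o e ≡ true  × lookup (edges G) e ≡ (u , v)) ⊎
     (lookup o e ≡ false × lookup (edges G) e ≡ (v , u)))

  Acyclic : Orientation → Set
  Acyclic o = ¬ (∃[ v ] TransClosure (Arc o) v v)

-- eNum N = Σ_{i=0}^{N} N!/i!, so that eNum N / N! = Σ_{i=0}^{N} 1/i!
-- (the N-th partial sum of the series for Euler's number e).
eNum : ℕ → ℕ
eNum zero    = 1
eNum (suc N) = suc N * eNum N + 1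

-- BoundedByE a m d  expresses  a ≤ (m·e/d)^d  using
-- (m·e/d)^d = sup_N (m · eNum N / (d · N!))^d  (an increasing sequence):
-- for every t, a - 1/(t+1) ≤ (m · eNum N / (d · N!))^d for some N,
-- with denominators cleared.
BoundedByE : ℕ → ℕ → ℕ → Set
BoundedByE a m d =
  ∀ t → ∃[ N ]
    suc t * a * (d ^ d * (N !) ^ d) ≤ suc t * (m ^ d * eNum N ^ d) + d ^ d * (N !) ^ d

module Submission where

-- Write d = n - k and a(G) for the number of acyclic orientations.  The
-- proof is by deletion–contraction on an edge uv.  An acyclic orientation
-- of G restricts to one of G - uv, and an orientation of G - uv that stays
-- acyclic with both directions of uv induces an acyclic orientation of
-- G / uv, so a(G) ≤ a(G - uv) + a(G / uv), where G / uv has one edge less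
-- and d one less (we keep v as an isolated vertex, a new component).
-- Induction on the number of edges gives, for all p ≤ q,
--     a(G) · p^d · q^m ≤ q^d · (q + p)^m,   i.e.  a ≤ (q/p)^d (1 + p/q)^m,
-- and d ≤ m because n ≤ m + k.  Taking p = d and q = m, it remains to see
-- (1 + d/m)^m ≤ (1 + 1/m)^(d m) ≤ (eNum m / m!)^d, by Bernoulli's
-- inequality and the binomial theorem.

open import Defs
open import Data.Nat using (ℕ; zero; suc; _+_; _*_; _^_; _≤_; _∸_; z≤n; s≤s; s≤s⁻¹; _!; >-nonZero)
open import Data.Nat.Properties
open import Data.Nat.DivMod using (m/n*n≡m)
open import Data.Nat.Combinatorics using (_C_; nCk≡n!/k![n-k]!; k![n∸k]!∣n!)
open import Data.Nat.Tactic.RingSolver using (solve-∀)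
open import Data.Fin using (Fin; zero; suc; toℕ)
import Data.Fin.Properties as FP
open import Data.Bool using (Bool; true; false)
import Data.Bool.Properties as BP
open import Data.Vec using (Vec; lookup; []; _∷_) renaming (map to mapVec)
import Data.Vec.Properties as VP
open import Data.List using (List; []; _∷_; length; _++_; filter)
open import Data.List.Properties using (length-++)
open import Data.List.Membership.Propositional using (_∈_)
open import Data.List.Membership.Propositional.Properties using (∈-++⁻; ∈-filter⁻)
open import Data.List.Relation.Unary.Any using (here; there)
import Data.List.Relation.Unary.All as All
open import Data.List.Relation.Unary.AllPairs using ([]; _∷_)
open import Data.List.Relation.Unary.Unique.Propositional using (Unique)
import Data.List.Relation.Unary.Unique.Propositional.Properties as Unique
open import Data.Product using (_×_; _,_; proj₁; proj₂; ∃-syntax)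
open import Data.Sum using (_⊎_; inj₁; inj₂)
open import Data.Empty using (⊥-elim)
open import Relation.Nullary using (¬_; Dec; yes; no)
open import Relation.Unary using (Pred; Decidable)
open import Relation.Unary.Properties using (∁?)
open import Relation.Binary.Definitions using (DecidableEquality)
open import Relation.Binary.PropositionalEquality
  using (_≡_; _≢_; refl; sym; trans; cong; cong₂; subst; subst₂; module ≡-Reasoning)
open import Relation.Binary.Construct.Closure.Transitive using (TransClosure; [_]; _∷_)
open import Relation.Binary.Construct.Closure.ReflexiveTransitive using (Star; ε; _◅_)
open import Algebra.Properties.Semiring.Sum +-*-semiring using (sum; sum-cong-≗; *-distribˡ-sum; *-distribʳ-sum)
import Algebra.Properties.CommutativeSemiring.Binomial +-*-commutativeSemiring as Binomial
import Algebra.Properties.Semiring.Exp +-*-semiring as SemiringExp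
import Algebra.Properties.Semiring.Mult +-*-semiring as SemiringMult

module Paths {V : Set} where

  map⁺ : {A B : V → V → Set} → (∀ {x y} → A x y → B x y) →
         ∀ {x y} → TransClosure A x y → TransClosure B x y
  map⁺ f [ a ]   = [ f a ]
  map⁺ f (a ∷ t) = f a ∷ map⁺ f t

  arc◅walk : {A : V → V → Set} → ∀ {x y z} → A x y → Star A y z → TransClosure A x z
  arc◅walk a ε       = [ a ]
  arc◅walk a (b ◅ s) = a ∷ arc◅walk b s

  WithArc : (V → V → Set) → V → V → V → V → Set
  WithArc A x₀ y₀ p q = A p q ⊎ (p ≡ x₀ × q ≡ y₀)

  avoid-or-reach : {A : V → V → Set} → ∀ {x₀ y₀ x y} →
    TransClosure (WithArc A x₀ y₀) x y → TransClosure A x y ⊎ Star A x x₀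
  avoid-or-reach [ inj₁ a ]             = inj₁ [ a ]
  avoid-or-reach [ inj₂ (refl , _) ]    = inj₂ ε
  avoid-or-reach (inj₂ (refl , _) ∷ _)  = inj₂ ε
  avoid-or-reach (inj₁ a ∷ t) with avoid-or-reach t
  ... | inj₁ t′ = inj₁ (a ∷ t′)
  ... | inj₂ s  = inj₂ (a ◅ s)

module Merge {V : Set} (_≟_ : DecidableEquality V) (u v : V) (u≢v : u ≢ v) where

  merge : V → V
  merge x with x ≟ v
  ... | yes _ = u
  ... | no _  = x

  merge-≢v : ∀ x → merge x ≢ v
  merge-≢v x with x ≟ v
  ... | yes _   = u≢v
  ... | no x≢v  = x≢v

  merge-fixes : ∀ x → x ≢ v → merge x ≡ x
  merge-fixes x x≢v with x ≟ v
  ... | yes x≡v = ⊥-elim (x≢v x≡v)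
  ... | no _    = refl

  merge-u≡merge-v : merge u ≡ merge v
  merge-u≡merge-v with v ≟ v
  ... | yes _  = merge-fixes u u≢v
  ... | no v≢v = ⊥-elim (v≢v refl)

  merge-fibres : ∀ x y → merge x ≡ merge y → x ≡ y ⊎ ((x ≡ u × y ≡ v) ⊎ (x ≡ v × y ≡ u))
  merge-fibres x y eq with x ≟ v | y ≟ v
  ... | yes x≡v | yes y≡v = inj₁ (trans x≡v (sym y≡v))
  ... | yes x≡v | no _    = inj₂ (inj₂ (x≡v , sym eq))
  ... | no _    | yes y≡v = inj₂ (inj₁ (eq , y≡v))
  ... | no _    | no _    = inj₁ eq

  Contracted : (V → V → Set) → V → V → Set
  Contracted A x y = ∃[ a ] ∃[ b ] (A a b × merge a ≡ x × merge b ≡ y)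

  module ContractionAcyclic (A : V → V → Set)
         (acyclic-uv : ¬ (∃[ w ] TransClosure (Paths.WithArc A u v) w w))
         (acyclic-vu : ¬ (∃[ w ] TransClosure (Paths.WithArc A v u) w w)) where
    open Paths

    Step : V → V → Set
    Step p q = ∃[ s ] (merge s ≡ merge p × A s q)

    unmerge : ∀ {x y} → TransClosure (Contracted A) x y →
      ∃[ b ] (merge b ≡ y × (∀ a → merge a ≡ x → TransClosure Step a b))
    unmerge [ a₀ , b₀ , ab , ma , mb ] = b₀ , mb , λ a ma′ → [ a₀ , trans ma (sym ma′) , ab ]
    unmerge ((a₀ , b₀ , ab , ma , mb) ∷ t) with unmerge t
    ... | b , mb′ , path = b , mb′ , λ a ma′ → (a₀ , trans ma (sym ma′) , ab) ∷ path b₀ mb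

    classify : ∀ {p q} → Step p q → A p q ⊎ ((p ≡ u × A v q) ⊎ (p ≡ v × A u q))
    classify {p} (s , eq , a) with merge-fibres s p eq
    ... | inj₁ refl                 = inj₁ a
    ... | inj₂ (inj₁ (refl , refl)) = inj₂ (inj₂ (refl , a))
    ... | inj₂ (inj₂ (refl , refl)) = inj₂ (inj₁ (refl , a))

    -- A Step-path never needs both jumps: between a jump into v and a later
    -- jump out of v (or likewise for u) lies a closed walk of A itself.
    jumps-one-way : ∀ {a b} → TransClosure Step a b →
      TransClosure (WithArc A u v) a b ⊎ TransClosure (WithArc A v u) a b
    jumps-one-way [ st ] with classify st
    ... | inj₁ a                 = inj₁ [ inj₁ a ]
    ... | inj₂ (inj₁ (refl , a)) = inj₁ (inj₂ (refl , refl) ∷ [ inj₁ a ])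
    ... | inj₂ (inj₂ (refl , a)) = inj₂ (inj₂ (refl , refl) ∷ [ inj₁ a ])
    jumps-one-way (st ∷ t) with classify st | jumps-one-way t
    ... | inj₁ a                 | inj₁ t′ = inj₁ (inj₁ a ∷ t′)
    ... | inj₁ a                 | inj₂ t′ = inj₂ (inj₁ a ∷ t′)
    ... | inj₂ (inj₁ (refl , a)) | inj₁ t′ = inj₁ (inj₂ (refl , refl) ∷ inj₁ a ∷ t′)
    ... | inj₂ (inj₂ (refl , a)) | inj₂ t′ = inj₂ (inj₂ (refl , refl) ∷ inj₁ a ∷ t′)
    ... | inj₂ (inj₁ (refl , a)) | inj₂ t′ with avoid-or-reach t′
    ...   | inj₁ t″ = inj₁ (inj₂ (refl , refl) ∷ inj₁ a ∷ map⁺ inj₁ t″)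
    ...   | inj₂ s  = ⊥-elim (acyclic-uv (v , map⁺ inj₁ (arc◅walk a s)))
    jumps-one-way (st ∷ t) | inj₂ (inj₂ (refl , a)) | inj₁ t′ with avoid-or-reach t′
    ...   | inj₁ t″ = inj₂ (inj₂ (refl , refl) ∷ inj₁ a ∷ map⁺ inj₁ t″)
    ...   | inj₂ s  = ⊥-elim (acyclic-uv (u , map⁺ inj₁ (arc◅walk a s)))

    contracted-acyclic : ¬ (∃[ w ] TransClosure (Contracted A) w w)
    contracted-acyclic (w , t) with unmerge t
    ... | b , mb , path with jumps-one-way (path b mb)
    ...   | inj₁ c = acyclic-uv (b , c)
    ...   | inj₂ c = acyclic-vu (b , c)

-- Deletion and contraction leave the class of simple graphs, so the
-- induction runs over arbitrary edge lists (multigraphs with loops); for a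
-- simple graph G, ArcE (edges G) and Acyc (edges G) are literally Arc G and
-- Acyclic G.
EdgeList : ℕ → ℕ → Set
EdgeList n m = Vec (Fin n × Fin n) m

module _ {n m : ℕ} (E : EdgeList n m) where

  Adjacent : Fin n → Fin n → Set
  Adjacent x y = ∃[ e ] (lookup E e ≡ (x , y) ⊎ lookup E e ≡ (y , x))

  ArcE : Vec Bool m → Fin n → Fin n → Set
  ArcE o x y = ∃[ e ] ((lookup o e ≡ true  × lookup E e ≡ (x , y)) ⊎
                       (lookup o e ≡ false × lookup E e ≡ (y , x)))

  Acyc : Vec Bool m → Set
  Acyc o = ¬ (∃[ w ] TransClosure (ArcE o) w w)

  Respects : ∀ {k} → (Fin n → Fin k) → Set
  Respects c = ∀ e → c (proj₁ (lookup E e)) ≡ c (proj₂ (lookup E e))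

IsOnto : ∀ {n k} → (Fin n → Fin k) → Set
IsOnto c = ∀ j → ∃[ i ] c i ≡ j

onto⇒≤ : ∀ {n k} (c : Fin n → Fin k) → IsOnto c → k ≤ n
onto⇒≤ c onto = FP.injective⇒≤ {f = λ j → proj₁ (onto j)}
  (λ {x} {y} eq → trans (sym (proj₂ (onto x))) (trans (cong c eq) (proj₂ (onto y))))

delete-acyclic : ∀ {n m} {e : Fin n × Fin n} {E : EdgeList n m} b o →
  Acyc (e ∷ E) (b ∷ o) → Acyc E o
delete-acyclic _ _ acyclic (w , t) = acyclic (w , Paths.map⁺ (λ { (e , arc) → suc e , arc }) t)

loop-cyclic : ∀ {n m} {u : Fin n} {E : EdgeList n m} o → ¬ Acyc ((u , u) ∷ E) o
loop-cyclic {u = u} (true  ∷ o) acyclic = acyclic (u , [ zero , inj₁ (refl , refl) ])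
loop-cyclic {u = u} (false ∷ o) acyclic = acyclic (u , [ zero , inj₂ (refl , refl) ])

-- Contracting the edge (u , v) ∷ E, u ≠ v: the remaining edges E with v
-- renamed to u, and the colouring that puts the now isolated v in a new class.
module EdgeContraction {n m : ℕ} (u v : Fin n) (u≢v : u ≢ v) (E : EdgeList n m) where
  open Merge FP._≟_ u v u≢v public

  mergeEdge : Fin n × Fin n → Fin n × Fin n
  mergeEdge (a , b) = merge a , merge b

  contract : EdgeList n m
  contract = mapVec mergeEdge E

  lookup-contract : ∀ e → lookup contract e ≡ mergeEdge (lookup E e)
  lookup-contract e = VP.lookup-map e mergeEdge E

  isolate : ∀ {k} → (Fin n → Fin k) → Fin n → Fin (suc k)
  isolate c x with x FP.≟ v
  ... | yes _ = zero
  ... | no _  = suc (c x)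

  isolate-v : ∀ {k} (c : Fin n → Fin k) {x} → x ≡ v → isolate c x ≡ zero
  isolate-v c {x} x≡v with x FP.≟ v
  ... | yes _  = refl
  ... | no x≢v = ⊥-elim (x≢v x≡v)

  isolate-≢v : ∀ {k} (c : Fin n → Fin k) x → x ≢ v → isolate c x ≡ suc (c x)
  isolate-≢v c x x≢v with x FP.≟ v
  ... | yes x≡v = ⊥-elim (x≢v x≡v)
  ... | no _    = refl

  module _ {k} (c : Fin n → Fin k) (cu≡cv : c u ≡ c v) where

    colour-merge : ∀ x → c (merge x) ≡ c x
    colour-merge x with x FP.≟ v
    ... | yes refl = cu≡cv
    ... | no _     = refl

    isolate-onto : IsOnto c → IsOnto (isolate c)
    isolate-onto onto zero = v , isolate-v c refl
    isolate-onto onto (suc j) with onto j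
    ... | i , ci≡j with i FP.≟ v
    ...   | yes refl = u , trans (isolate-≢v c u u≢v) (cong suc (trans cu≡cv ci≡j))
    ...   | no i≢v   = i , trans (isolate-≢v c i i≢v) (cong suc ci≡j)

    isolate-respects : Respects ((u , v) ∷ E) c → Respects contract (isolate c)
    isolate-respects resp e
      rewrite lookup-contract e
      = trans (isolate-≢v c _ (merge-≢v a))
          (trans (cong suc (trans (colour-merge a) (trans (resp (suc e)) (sym (colour-merge b)))))
                 (sym (isolate-≢v c _ (merge-≢v b))))
      where a = proj₁ (lookup E e)
            b = proj₂ (lookup E e)

  contract-acyclic : ∀ o → Acyc ((u , v) ∷ E) (true ∷ o) → Acyc ((u , v) ∷ E) (false ∷ o) →
    Acyc contract o
  contract-acyclic o acyclic-uv acyclic-vu (w , t) =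
    ContractionAcyclic.contracted-acyclic (ArcE E o) cyclic-uv cyclic-vu
      (w , Paths.map⁺ contracted-arc t)
    where
    open Paths
    contracted-arc : ∀ {x y} → ArcE contract o x y → Contracted (ArcE E o) x y
    contracted-arc (e , inj₁ (oe , eq)) =
      let eq′ = trans (sym (lookup-contract e)) eq in
      _ , _ , (e , inj₁ (oe , refl)) , cong proj₁ eq′ , cong proj₂ eq′
    contracted-arc (e , inj₂ (oe , eq)) =
      let eq′ = trans (sym (lookup-contract e)) eq in
      _ , _ , (e , inj₂ (oe , refl)) , cong proj₂ eq′ , cong proj₁ eq′
    cyclic-uv : ¬ (∃[ w ] TransClosure (WithArc (ArcE E o) u v) w w)
    cyclic-uv (w , t) = acyclic-uv (w , map⁺ (λ { (inj₁ (e , arc)) → suc e , arc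
                                                 ; (inj₂ (refl , refl)) → zero , inj₁ (refl , refl) }) t)
    cyclic-vu : ¬ (∃[ w ] TransClosure (WithArc (ArcE E o) v u) w w)
    cyclic-vu (w , t) = acyclic-vu (w , map⁺ (λ { (inj₁ (e , arc)) → suc e , arc
                                                 ; (inj₂ (refl , refl)) → zero , inj₂ (refl , refl) }) t)

  merge-walk : ∀ {x y} → Star (Adjacent ((u , v) ∷ E)) x y → Star (Adjacent contract) (merge x) (merge y)
  merge-walk ε = ε
  merge-walk {y = y} ((zero , inj₁ refl) ◅ s) =
    subst (λ z → Star (Adjacent contract) z (merge y)) (sym merge-u≡merge-v) (merge-walk s)
  merge-walk {y = y} ((zero , inj₂ refl) ◅ s) =
    subst (λ z → Star (Adjacent contract) z (merge y)) merge-u≡merge-v (merge-walk s)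
  merge-walk ((suc e , inj₁ eq) ◅ s) = (e , inj₁ (trans (lookup-contract e) (cong mergeEdge eq))) ◅ merge-walk s
  merge-walk ((suc e , inj₂ eq) ◅ s) = (e , inj₂ (trans (lookup-contract e) (cong mergeEdge eq))) ◅ merge-walk s

  isolate-connected : ∀ {k} (c : Fin n → Fin k) →
    (∀ i j → c i ≡ c j → Star (Adjacent ((u , v) ∷ E)) i j) →
    ∀ i j → isolate c i ≡ isolate c j → Star (Adjacent contract) i j
  isolate-connected c conn i j eq = by-cases (i FP.≟ v) (j FP.≟ v)
    where
    by-cases : Dec (i ≡ v) → Dec (j ≡ v) → Star (Adjacent contract) i j
    by-cases (yes i≡v) (yes j≡v) = subst (Star (Adjacent contract) i) (trans i≡v (sym j≡v)) ε
    by-cases (yes i≡v) (no j≢v)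
      with () ← trans (sym (isolate-v c i≡v)) (trans eq (isolate-≢v c j j≢v))
    by-cases (no i≢v)  (yes j≡v)
      with () ← trans (sym (isolate-v c j≡v)) (trans (sym eq) (isolate-≢v c i i≢v))
    by-cases (no i≢v)  (no j≢v)  =
      subst₂ (Star (Adjacent contract)) (merge-fixes i i≢v) (merge-fixes j j≢v)
        (merge-walk (conn i j (FP.suc-injective
          (trans (sym (isolate-≢v c i i≢v)) (trans eq (isolate-≢v c j j≢v))))))

-- A graph with m edges whose colour classes under c : Fin n → Fin k are
-- connected has n ≤ m + k: each edge merges at most two classes.
vertices≤edges+classes : ∀ {n k} m (E : EdgeList n m) (c : Fin n → Fin k) →
  (∀ i j → c i ≡ c j → Star (Adjacent E) i j) → n ≤ m + k
vertices≤edges+classes zero [] c conn = FP.injective⇒≤ {f = c} (λ {x} {y} eq → no-edges (conn x y eq))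
  where
  no-edges : ∀ {x y} → Star (Adjacent []) x y → x ≡ y
  no-edges ε = refl
  no-edges ((() , _) ◅ _)
vertices≤edges+classes {n} (suc m) ((u , v) ∷ E) c conn with u FP.≟ v
... | yes refl = m≤n⇒m≤1+n (vertices≤edges+classes m E c (λ i j eq → drop-loop (conn i j eq)))
  where
  drop-loop : ∀ {x y} → Star (Adjacent ((u , u) ∷ E)) x y → Star (Adjacent E) x y
  drop-loop ε = ε
  drop-loop ((zero , inj₁ refl) ◅ s) = drop-loop s
  drop-loop ((zero , inj₂ refl) ◅ s) = drop-loop s
  drop-loop ((suc e , adj) ◅ s) = (e , adj) ◅ drop-loop s
... | no u≢v = subst (n ≤_) (+-suc m _)
  (vertices≤edges+classes m contract (isolate c) (isolate-connected c conn))
  where open EdgeContraction u v u≢v E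

length-filter-∁ : ∀ {a p} {A : Set a} {P : Pred A p} (P? : Decidable P) xs →
  length xs ≡ length (filter P? xs) + length (filter (∁? P?) xs)
length-filter-∁ P? [] = refl
length-filter-∁ P? (x ∷ xs) with P? x
... | yes _ = cong suc (length-filter-∁ P? xs)
... | no _  = trans (cong suc (length-filter-∁ P? xs)) (sym (+-suc _ _))

module _ {m : ℕ} where

  withHead : Bool → List (Vec Bool (suc m)) → List (Vec Bool m)
  withHead b [] = []
  withHead true  ((true  ∷ o) ∷ L) = o ∷ withHead true L
  withHead true  ((false ∷ o) ∷ L) = withHead true L
  withHead false ((true  ∷ o) ∷ L) = withHead false L
  withHead false ((false ∷ o) ∷ L) = o ∷ withHead false L

  length-withHead : ∀ L → length L ≡ length (withHead true L) + length (withHead false L)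
  length-withHead [] = refl
  length-withHead ((true  ∷ o) ∷ L) = cong suc (length-withHead L)
  length-withHead ((false ∷ o) ∷ L) = trans (cong suc (length-withHead L)) (sym (+-suc _ _))

  ∈-withHead : ∀ b L {o} → o ∈ withHead b L → (b ∷ o) ∈ L
  ∈-withHead true  ((true  ∷ o) ∷ L) (here refl) = here refl
  ∈-withHead true  ((true  ∷ o) ∷ L) (there p)   = there (∈-withHead true L p)
  ∈-withHead true  ((false ∷ o) ∷ L) p           = there (∈-withHead true L p)
  ∈-withHead false ((true  ∷ o) ∷ L) p           = there (∈-withHead false L p)
  ∈-withHead false ((false ∷ o) ∷ L) (here refl) = here refl
  ∈-withHead false ((false ∷ o) ∷ L) (there p)   = there (∈-withHead false L p)

  withHead-unique : ∀ b L → Unique L → Unique (withHead b L)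
  withHead-unique b [] _ = []
  withHead-unique true  ((true  ∷ o) ∷ L) (o∉L ∷ u) =
    All.tabulate (λ p eq → All.lookup o∉L (∈-withHead true L p) (cong (true ∷_) eq)) ∷ withHead-unique true L u
  withHead-unique true  ((false ∷ o) ∷ L) (_ ∷ u) = withHead-unique true L u
  withHead-unique false ((true  ∷ o) ∷ L) (_ ∷ u) = withHead-unique false L u
  withHead-unique false ((false ∷ o) ∷ L) (o∉L ∷ u) =
    All.tabulate (λ p eq → All.lookup o∉L (∈-withHead false L p) (cong (false ∷_) eq)) ∷ withHead-unique false L u

  record TailSplit (L : List (Vec Bool (suc m))) : Set where
    field
      tails common  : List (Vec Bool m)
      count         : length L ≡ length tails + length common
      tails-unique  : Unique tails
      common-unique : Unique common
      tails-sound   : ∀ {o} → o ∈ tails → ∃[ b ] (b ∷ o) ∈ L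
      common-sound  : ∀ {o} → o ∈ common → (true ∷ o) ∈ L × (false ∷ o) ∈ L

  tailSplit : ∀ L → Unique L → TailSplit L
  tailSplit L uniqueL = record
    { tails         = T ++ Fonly
    ; common        = Both
    ; count         = count
    ; tails-unique  = Unique.++⁺ (withHead-unique true L uniqueL) (Unique.filter⁺ (_∉? T) uF)
                        (λ (o∈T , o∈Fonly) → proj₂ (∈-filter⁻ (_∉? T) {xs = F} o∈Fonly) o∈T)
    ; common-unique = Unique.filter⁺ (_∈? T) uF
    ; tails-sound   = tails-sound
    ; common-sound  = λ o∈ → let (o∈F , o∈T) = ∈-filter⁻ (_∈? T) {xs = F} o∈ in
                               ∈-withHead true L o∈T , ∈-withHead false L o∈F
    }
    where
    open import Data.List.Membership.DecPropositional (VP.≡-dec BP._≟_) using (_∈?_; _∉?_)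
    T F Fonly Both : List (Vec Bool m)
    T     = withHead true L
    F     = withHead false L
    Fonly = filter (_∉? T) F
    Both  = filter (_∈? T) F
    uF : Unique F
    uF = withHead-unique false L uniqueL

    count : length L ≡ length (T ++ Fonly) + length Both
    count = begin
      length L                                 ≡⟨ length-withHead L ⟩
      length T + length F                      ≡⟨ cong (length T +_) (length-filter-∁ (_∈? T) F) ⟩
      length T + (length Both + length Fonly)  ≡⟨ cong (length T +_) (+-comm (length Both) _) ⟩
      length T + (length Fonly + length Both)  ≡⟨ sym (+-assoc (length T) _ _) ⟩
      length T + length Fonly + length Both    ≡⟨ cong (_+ length Both) (sym (length-++ T)) ⟩
      length (T ++ Fonly) + length Both        ∎
      where open ≡-Reasoning

    tails-sound : ∀ {o} → o ∈ T ++ Fonly → ∃[ b ] (b ∷ o) ∈ L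
    tails-sound o∈ with ∈-++⁻ T o∈
    ... | inj₁ o∈T     = true , ∈-withHead true L o∈T
    ... | inj₂ o∈Fonly = false , ∈-withHead false L (proj₁ (∈-filter⁻ (_∉? T) {xs = F} o∈Fonly))

-- The bound a ≤ (q/p)^d · (1 + p/q)^m on a count a, denominators cleared.
Bound : (p q a d m : ℕ) → Set
Bound p q a d m = a * p ^ d * q ^ m ≤ q ^ d * (q + p) ^ m

bound-step : ∀ {p q} a₁ a₂ d m → Bound p q a₁ (suc d) m → Bound p q a₂ d m →
  Bound p q (a₁ + a₂) (suc d) (suc m)
bound-step {p} {q} a₁ a₂ d m deleted contracted =
  subst₂ _≤_ (lhs a₁ a₂ p q (p ^ d) (q ^ m)) (rhs p q (q ^ d) ((q + p) ^ m))
    (+-mono-≤ (*-monoʳ-≤ q deleted) (*-monoʳ-≤ (p * q) contracted))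
  where
  lhs : ∀ a₁ a₂ p q P Q → q * (a₁ * (p * P) * Q) + p * q * (a₂ * P * Q) ≡ (a₁ + a₂) * (p * P) * (q * Q)
  lhs = solve-∀
  rhs : ∀ p q Q X → q * (q * Q * X) + p * q * (Q * X) ≡ (q * Q) * ((q + p) * X)
  rhs = solve-∀

∸-suc : ∀ {n k} → suc k ≤ n → n ∸ k ≡ suc (n ∸ suc k)
∸-suc {suc n} {zero}  _         = refl
∸-suc {suc n} {suc k} (s≤s k<n) = ∸-suc k<n

module DeletionContraction (p q : ℕ) (p≤q : p ≤ q) where

  no-edges : ∀ d (L : List (Vec Bool 0)) → Unique L → Bound p q (length L) d 0
  no-edges d []            _ = z≤n
  no-edges d ([] ∷ [])     _ = subst₂ _≤_ (sym (trans (*-identityʳ _) (*-identityˡ _))) (sym (*-identityʳ _))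
    (^-monoˡ-≤ d p≤q)
  no-edges d ([] ∷ [] ∷ _) (distinct ∷ _) = ⊥-elim (All.head distinct refl)

  acyclic-bound : ∀ {n k} m (E : EdgeList n m) (c : Fin n → Fin k) → IsOnto c → Respects E c →
    (L : List (Vec Bool m)) → Unique L → (∀ {o} → o ∈ L → Acyc E o) →
    Bound p q (length L) (n ∸ k) m
  acyclic-bound {n} {k} zero [] c _ _ L uniqueL _ = no-edges (n ∸ k) L uniqueL
  acyclic-bound (suc m) ((u , v) ∷ E) c onto resp [] _ _ = z≤n
  -- An acyclic orientation exists, so the first edge is not a loop.
  acyclic-bound (suc m) ((u , v) ∷ E) c onto resp (o ∷ L) _ acyclic with u FP.≟ v
  ... | yes refl = ⊥-elim (loop-cyclic o (acyclic (here refl)))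
  acyclic-bound {n} {k} (suc m) ((u , v) ∷ E) c onto resp L uniqueL acyclic | no u≢v =
    subst₂ (λ a d → Bound p q a d (suc m)) (sym count) (sym d≡1+d′)
      (bound-step (length tails) (length common) (n ∸ suc k) m deleted′ contracted)
    where
    open EdgeContraction u v u≢v E
    open TailSplit (tailSplit L uniqueL)
    isolate-onto′ : IsOnto (isolate c)
    isolate-onto′ = isolate-onto c (resp zero) onto
    -- The contraction has one more colour class, so d drops by one.
    d≡1+d′ : n ∸ k ≡ suc (n ∸ suc k)
    d≡1+d′ = ∸-suc (onto⇒≤ (isolate c) isolate-onto′)
    deleted : Bound p q (length tails) (n ∸ k) m
    deleted = acyclic-bound m E c onto (λ e → resp (suc e)) tails tails-unique
      (λ o∈ → let (b , bo∈L) = tails-sound o∈ in delete-acyclic b _ (acyclic bo∈L))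
    deleted′ : Bound p q (length tails) (suc (n ∸ suc k)) m
    deleted′ = subst (λ d → Bound p q (length tails) d m) d≡1+d′ deleted
    contracted : Bound p q (length common) (n ∸ suc k) m
    contracted = acyclic-bound m contract (isolate c) isolate-onto′ (isolate-respects c (resp zero) resp)
      common common-unique
      (λ o∈ → let (t , f) = common-sound o∈ in contract-acyclic _ (acyclic t) (acyclic f))

sum-mono : ∀ {n} (f g : Fin n → ℕ) → (∀ i → f i ≤ g i) → sum f ≤ sum g
sum-mono {zero}  f g f≤g = z≤n
sum-mono {suc n} f g f≤g = +-mono-≤ (f≤g zero) (sum-mono (λ i → f (suc i)) (λ i → g (suc i)) (λ i → f≤g (suc i)))

falling : ℕ → ℕ → ℕ
falling N       zero    = 1
falling zero    (suc j) = 0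
falling (suc N) (suc j) = suc N * falling N j

eNum≡Σfalling : ∀ N → eNum N ≡ sum {suc N} (λ j → falling N (toℕ j))
eNum≡Σfalling zero    = refl
eNum≡Σfalling (suc N) = begin
  suc N * eNum N + 1                                   ≡⟨ +-comm (suc N * eNum N) 1 ⟩
  1 + suc N * eNum N                                   ≡⟨ cong (λ s → 1 + suc N * s) (eNum≡Σfalling N) ⟩
  1 + suc N * sum {suc N} (λ j → falling N (toℕ j))    ≡⟨ cong (1 +_) (*-distribˡ-sum {suc N} (suc N) (λ j → falling N (toℕ j))) ⟩
  1 + sum {suc N} (λ j → suc N * falling N (toℕ j))    ∎
  where open ≡-Reasoning

falling*factorial : ∀ m k → k ≤ m → falling m k * (m ∸ k) ! ≡ m !
falling*factorial m       zero    _         = *-identityˡ (m !)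
falling*factorial (suc m) (suc k) (s≤s k≤m) =
  trans (*-assoc (suc m) (falling m k) _) (cong (suc m *_) (falling*factorial m k k≤m))

choose*factorial : ∀ m k → k ≤ m → (m C k) * k ! ≡ falling m k
choose*factorial m k k≤m = *-cancelʳ-≡ _ _ ((m ∸ k) !) {{(m ∸ k) !≢0}} (begin
  (m C k) * k ! * (m ∸ k) !       ≡⟨ *-assoc (m C k) (k !) _ ⟩
  (m C k) * (k ! * (m ∸ k) !)     ≡⟨ exact-division ⟩
  m !                             ≡⟨ sym (falling*factorial m k k≤m) ⟩
  falling m k * (m ∸ k) !         ∎)
  where
  open ≡-Reasoning
  exact-division : (m C k) * (k ! * (m ∸ k) !) ≡ m !
  exact-division = trans (cong (_* (k ! * (m ∸ k) !)) (nCk≡n!/k![n-k]! k≤m))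
                         (m/n*n≡m {{k !* (m ∸ k) !≢0}} (k![n∸k]!∣n! k≤m))

factorial-ratio≤power : ∀ x k n → k ≤ n → n ≤ x → x ^ k * n ! ≤ x ^ n * k !
factorial-ratio≤power x k n k≤n n≤x with m≤n⇒m<n∨m≡n k≤n
... | inj₂ refl = ≤-refl
factorial-ratio≤power x k (suc n) _ n<x | inj₁ (s≤s k≤n) = begin
  x ^ k * (suc n * n !)  ≡⟨ swap-front (x ^ k) (suc n) (n !) ⟩
  suc n * (x ^ k * n !)  ≤⟨ *-monoʳ-≤ (suc n) (factorial-ratio≤power x k n k≤n (≤-trans (n≤1+n n) n<x)) ⟩
  suc n * (x ^ n * k !)  ≤⟨ *-monoˡ-≤ (x ^ n * k !) n<x ⟩
  x * (x ^ n * k !)      ≡⟨ *-assoc x (x ^ n) (k !) ⟨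
  x * x ^ n * k !        ∎
  where
  open ≤-Reasoning
  swap-front : ∀ a b c → a * (b * c) ≡ b * (a * c)
  swap-front = solve-∀

-- The library's binomial theorem is phrased with a semiring's generic
-- powers and multiples; on ℕ these are _^_ and _*_.
semiring-^≡^ : ∀ x n → x SemiringExp.^ n ≡ x ^ n
semiring-^≡^ x zero    = refl
semiring-^≡^ x (suc n) = cong (x *_) (semiring-^≡^ x n)

semiring-×≡* : ∀ n x → n SemiringMult.× x ≡ n * x
semiring-×≡* zero    x = refl
semiring-×≡* (suc n) x = cong (x +_) (semiring-×≡* n x)

binomial-theorem : ∀ x m → (x + 1) ^ m ≡ sum {suc m} (λ k → (m C toℕ k) * x ^ toℕ k)
binomial-theorem x m = begin
  (x + 1) ^ m                                   ≡⟨ semiring-^≡^ (x + 1) m ⟨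
  (x + 1) SemiringExp.^ m                       ≡⟨ Binomial.theorem m x 1 ⟩
  sum {suc m} (Binomial.binomialTerm x 1 m)     ≡⟨ sum-cong-≗ {suc m} term ⟩
  sum {suc m} (λ k → (m C toℕ k) * x ^ toℕ k)   ∎
  where
  open ≡-Reasoning
  term : ∀ k → Binomial.binomialTerm x 1 m k ≡ (m C toℕ k) * x ^ toℕ k
  term k = trans (semiring-×≡* (m C toℕ k) _) (cong ((m C toℕ k) *_)
    (trans (cong₂ _*_ (semiring-^≡^ x (toℕ k)) (trans (semiring-^≡^ 1 (m ∸ toℕ k)) (^-zeroˡ (m ∸ toℕ k))))
           (*-identityʳ _)))

-- (1 + 1/m)^m ≤ eNum m / m!: term by term, (m C k) m^{k-m} ≤ 1/(m-k)!.
compound≤partialE : ∀ m → suc m ^ m * m ! ≤ m ^ m * eNum m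
compound≤partialE m = begin
  suc m ^ m * m !                                       ≡⟨ cong (λ y → y ^ m * m !) (+-comm 1 m) ⟩
  (m + 1) ^ m * m !                                     ≡⟨ cong (_* m !) (binomial-theorem m m) ⟩
  sum {suc m} (λ k → (m C toℕ k) * m ^ toℕ k) * m !     ≡⟨ *-distribʳ-sum {suc m} (m !) (λ k → (m C toℕ k) * m ^ toℕ k) ⟩
  sum {suc m} (λ k → (m C toℕ k) * m ^ toℕ k * m !)     ≤⟨ sum-mono {suc m} _ _ term≤ ⟩
  sum {suc m} (λ k → m ^ m * falling m (toℕ k))         ≡⟨ *-distribˡ-sum {suc m} (m ^ m) (λ k → falling m (toℕ k)) ⟨
  m ^ m * sum {suc m} (λ k → falling m (toℕ k))         ≡⟨ cong (m ^ m *_) (eNum≡Σfalling m) ⟨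
  m ^ m * eNum m                                        ∎
  where
  open ≤-Reasoning
  term≤ : ∀ k → (m C toℕ k) * m ^ toℕ k * m ! ≤ m ^ m * falling m (toℕ k)
  term≤ k = let k≤m = s≤s⁻¹ (FP.toℕ<n k) in begin
    (m C toℕ k) * m ^ toℕ k * m !      ≡⟨ *-assoc (m C toℕ k) _ _ ⟩
    (m C toℕ k) * (m ^ toℕ k * m !)    ≤⟨ *-monoʳ-≤ (m C toℕ k) (factorial-ratio≤power m (toℕ k) m k≤m ≤-refl) ⟩
    (m C toℕ k) * (m ^ m * toℕ k !)    ≡⟨ swap-front (m C toℕ k) (m ^ m) (toℕ k !) ⟩
    m ^ m * ((m C toℕ k) * toℕ k !)    ≡⟨ cong (m ^ m *_) (choose*factorial m (toℕ k) k≤m) ⟩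
    m ^ m * falling m (toℕ k)          ∎
    where
    swap-front : ∀ a b c → a * (b * c) ≡ b * (a * c)
    swap-front = solve-∀

bernoulli : ∀ m d → (m + suc d) * m ^ d ≤ suc m ^ suc d
bernoulli m zero    = ≤-reflexive (cong (_* 1) (+-comm m 1))
bernoulli m (suc d) = begin
  (m + suc (suc d)) * (m * m ^ d)                      ≤⟨ m≤m+n _ (suc d * m ^ d) ⟩
  (m + suc (suc d)) * (m * m ^ d) + suc d * m ^ d      ≡⟨ expand m d (m ^ d) ⟩
  suc m * ((m + suc d) * m ^ d)                        ≤⟨ *-monoʳ-≤ (suc m) (bernoulli m d) ⟩
  suc m * suc m ^ suc d                                ∎
  where
  open ≤-Reasoning
  expand : ∀ m d X → (m + suc (suc d)) * (m * X) + suc d * X ≡ suc m * ((m + suc d) * X)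
  expand = solve-∀

^-distribʳ-* : ∀ a b n → (a * b) ^ n ≡ a ^ n * b ^ n
^-distribʳ-* a b zero    = refl
^-distribʳ-* a b (suc n) = trans (cong (a * b *_) (^-distribʳ-* a b n)) (regroup a b (a ^ n) (b ^ n))
  where
  regroup : ∀ a b x y → a * b * (x * y) ≡ a * x * (b * y)
  regroup = solve-∀

^-swap : ∀ a n o → (a ^ n) ^ o ≡ (a ^ o) ^ n
^-swap a n o = trans (^-*-assoc a n o) (trans (cong (a ^_) (*-comm n o)) (sym (^-*-assoc a o n)))

-- (1 + d/m)^m ≤ (eNum m / m!)^d for m ≥ 1: by Bernoulli
-- (1 + d/m)^m ≤ (1 + 1/m)^(d m), and (1 + 1/m)^m ≤ eNum m / m!.
compound≤partialE^ : ∀ m d → 1 ≤ m → (m + d) ^ m * (m !) ^ d ≤ m ^ m * eNum m ^ d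
compound≤partialE^ m zero _ = ≤-reflexive (cong (λ y → y ^ m * 1) (+-identityʳ m))
compound≤partialE^ m@(suc _) (suc d) _ =
  *-cancelʳ-≤ _ _ P {{m^n≢0 (m ^ m) d {{m^n≢0 m m}}}} (begin
    (m + suc d) ^ m * F * P              ≡⟨ swap-last ((m + suc d) ^ m) F P ⟩
    (m + suc d) ^ m * P * F              ≤⟨ *-monoˡ-≤ F by-bernoulli ⟩
    (suc m ^ m) ^ suc d * F              ≡⟨ ^-distribʳ-* (suc m ^ m) (m !) (suc d) ⟨
    (suc m ^ m * m !) ^ suc d            ≤⟨ ^-monoˡ-≤ (suc d) (compound≤partialE m) ⟩
    (m ^ m * eNum m) ^ suc d             ≡⟨ ^-distribʳ-* (m ^ m) (eNum m) (suc d) ⟩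
    m ^ m * P * eNum m ^ suc d           ≡⟨ swap-last (m ^ m) P (eNum m ^ suc d) ⟩
    m ^ m * eNum m ^ suc d * P           ∎)
  where
  open ≤-Reasoning
  F = (m !) ^ suc d
  P = (m ^ m) ^ d
  by-bernoulli : (m + suc d) ^ m * P ≤ (suc m ^ m) ^ suc d
  by-bernoulli = subst₂ _≤_
    (trans (^-distribʳ-* (m + suc d) (m ^ d) m) (cong ((m + suc d) ^ m *_) (^-swap m d m)))
    (^-swap (suc m) (suc d) m)
    (^-monoˡ-≤ m (bernoulli m d))
  swap-last : ∀ a b c → a * b * c ≡ a * c * b
  swap-last = solve-∀

-- With p = d and q = m the deletion–contraction bound gives
-- a ≤ (m/d)^d (1 + d/m)^m ≤ (m/d)^d (eNum m / m!)^d.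
partialE-bound : ∀ a m d → 1 ≤ m → Bound d m a d m → a * (d ^ d * (m !) ^ d) ≤ m ^ d * eNum m ^ d
partialE-bound a m d 1≤m counted = *-cancelʳ-≤ _ _ (m ^ m) {{m^n≢0 m m {{>-nonZero 1≤m}}}} (begin
  a * (d ^ d * (m !) ^ d) * m ^ m     ≡⟨ regroup a (d ^ d) ((m !) ^ d) (m ^ m) ⟩
  a * d ^ d * m ^ m * (m !) ^ d       ≤⟨ *-monoˡ-≤ ((m !) ^ d) counted ⟩
  m ^ d * (m + d) ^ m * (m !) ^ d     ≡⟨ *-assoc (m ^ d) _ _ ⟩
  m ^ d * ((m + d) ^ m * (m !) ^ d)   ≤⟨ *-monoʳ-≤ (m ^ d) (compound≤partialE^ m d 1≤m) ⟩
  m ^ d * (m ^ m * eNum m ^ d)        ≡⟨ swap-back (m ^ d) (m ^ m) (eNum m ^ d) ⟩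
  m ^ d * eNum m ^ d * m ^ m          ∎)
  where
  open ≤-Reasoning
  regroup : ∀ a b c x → a * (b * c) * x ≡ a * b * x * c
  regroup = solve-∀
  swap-back : ∀ a b c → a * (b * c) ≡ a * c * b
  swap-back = solve-∀

-- A bound by the m-th partial sum of e already gives the bound by e,
-- witnessed at N = m for every tolerance 1/(t+1).
bounded-by-e : ∀ a m d → a * (d ^ d * (m !) ^ d) ≤ m ^ d * eNum m ^ d → BoundedByE a m d
bounded-by-e a m d bound t = m , (begin
  suc t * a * (d ^ d * (m !) ^ d)                      ≡⟨ *-assoc (suc t) a _ ⟩
  suc t * (a * (d ^ d * (m !) ^ d))                    ≤⟨ *-monoʳ-≤ (suc t) bound ⟩
  suc t * (m ^ d * eNum m ^ d)                         ≤⟨ m≤m+n _ (d ^ d * (m !) ^ d) ⟩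
  suc t * (m ^ d * eNum m ^ d) + d ^ d * (m !) ^ d     ∎)
  where open ≤-Reasoning

-- The theorem; of the characterisation of L only "every listed orientation
-- is acyclic" is used.
proposition3p6 : ∀ {n m k : ℕ} (G : SimpleGraph n m) → 1 ≤ m → HasComponents G k →
    (L : List (Vec Bool m)) → Unique L →
    (∀ o → (o ∈ L → Acyclic G o) × (Acyclic G o → o ∈ L)) →
    BoundedByE (length L) m (n ∸ k)
proposition3p6 {n} {m} {k} G 1≤m (c , onto , components) L uniqueL acyclic-orientations =
  bounded-by-e (length L) m d (partialE-bound (length L) m d 1≤m counted)
  where
  d : ℕ
  d = n ∸ k
  respects : Respects (edges G) c
  respects e = proj₂ (components _ _) ((e , inj₁ refl) ◅ ε)
  d≤m : d ≤ m
  d≤m = m≤n+o⇒m∸n≤o n k (subst (n ≤_) (+-comm m k)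
    (vertices≤edges+classes m (edges G) c (λ i j → proj₁ (components i j))))
  counted : Bound d m (length L) d m
  counted = DeletionContraction.acyclic-bound d m d≤m m (edges G) c onto respects L uniqueL
    (λ {o} o∈L → proj₁ (acyclic-orientations o) o∈L)
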